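{- Throw $A$ good balls and $B$ bad balls into $K$ bins, each ball independently and uniformly at random, and let $X$ be the number of bins that contain at least one good ball and no bad balls. If $A,B\le K/4$, then $\mathbf{Var}[X]\le7K$. -}

module Defs where

open import Data.Nat using (ℕ; zero; suc)
import Data.Nat as ℕ
open import Data.Integer using (+_)
open import Data.Bool using (Bool; true; false; _∧_; not)
open import Data.Fin using (Fin; _≟_)
open import Data.List using (List; []; _∷_; [_]; map; concatMap; length; filter; foldr; cartesianProduct)
import Data.List as L
open import Data.Vec using (Vec; []; _∷_; toList)
open import Data.Product using (_×_; _,_)
open import Data.Bool.ListAction using (any)
open import Data.Nat.ListAction using (sum)
open import Data.Rational using (ℚ; _/_; _+_; _*_; _-_; 0ℚ)
open import Relation.Nullary.Decidable using (⌊_⌋)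
open import Relation.Unary using (Decidable)
open import Relation.Nullary.Decidable using (yes; no)

allPlacements : (K n : ℕ) → List (Vec (Fin K) n)
allPlacements K zero = [ [] ]
allPlacements K (suc n) = concatMap (λ i → map (i ∷_) (allPlacements K n)) (Data.List.allFin K)

hits : ∀ {K n} → Fin K → Vec (Fin K) n → Bool
hits j v = any (λ x → ⌊ x ≟ j ⌋) (toList v)

X : ∀ {K A B} → Vec (Fin K) A × Vec (Fin K) B → ℕ
X {K} (good , bad) = length (L.filterᵇ (λ j → hits j good ∧ not (hits j bad)) (Data.List.allFin K))

outcomes : (K A B : ℕ) → List (Vec (Fin K) A × Vec (Fin K) B)
outcomes K A B = cartesianProduct (allPlacements K A) (allPlacements K B)

-- Expectation under the uniform distribution on a (listed) finite sample space.
-- (The empty list never occurs for nonempty sample spaces; value 0 is a convention.)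
expect : ∀ {Ω : Set} → List Ω → (Ω → ℕ) → ℚ
expect [] f = 0ℚ
expect (ω ∷ ωs) f = (+ sum (map f (ω ∷ ωs))) / suc (length ωs)

Var : ∀ {Ω : Set} → List Ω → (Ω → ℕ) → ℚ
Var ωs f = expect ωs (λ ω → f ω ℕ.* f ω) - expect ωs f * expect ωs f

module Submission where

-- Write N² Var[f] = N ∑ f² - (∑ f)² for the uniform distribution on
-- a listed sample space of N points; it is an integer, so the whole argument runs
-- in ℤ and is converted to the rational Var of Defs only at the end.
--
-- 1. Law of total variance for a space made of equal-size blocks, and the crude
--    bound Var[f] ≤ d² when all values of f lie within distance d of each other.
-- 2. Bounded-differences (Efron–Stein type) inequality: if f on n independent
--    uniform coordinates moves by at most d when one coordinate changes, then
--    Var[f] ≤ n d².  Induction on n, conditioning on the first coordinate.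
-- 3. On the product space of good and bad placements, bounded differences in
--    every ball give Var ≤ (A + B) d².
-- 4. X counts bins according to whether they are hit by good and by bad balls;
--    moving one ball changes only its old and new bin, so d = 2.
-- Hence Var[X] ≤ 4 (A + B) ≤ 2K ≤ 7K.

open import Data.Nat as ℕ using (ℕ; zero; suc; z≤n; s≤s)
import Data.Nat.Properties as ℕP
open import Data.Nat.ListAction using (sum)
open import Data.Integer as ℤ using (ℤ; +_; -[1+_]; 0ℤ; 1ℤ; _+_; _-_; _*_; _≤_; +≤+)
import Data.Integer.Properties as ℤP
open import Data.Integer.Tactic.RingSolver using (solve-∀)
open import Data.Rational as ℚ using (_/_; toℚᵘ)
import Data.Rational.Properties as ℚP
open import Data.Rational.Unnormalised as ℚᵘ using (mkℚᵘ; *≤*)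
import Data.Rational.Unnormalised.Properties as ℚᵘP
open import Data.Bool using (Bool; true; false; _∨_; _∧_; not)
open import Data.Fin using (Fin; zero; suc; _≟_)
open import Data.Vec using (Vec; []; _∷_; lookup; _[_]≔_)
open import Data.List using (List; []; _∷_; _++_; map; length; concatMap; cartesianProduct; allFin; filterᵇ)
import Data.List.Properties as ListP
open import Data.List.Relation.Unary.All as All using (All)
open import Data.List.Relation.Unary.Unique.Propositional using (Unique; []; _∷_)
open import Data.List.Relation.Unary.Unique.Propositional.Properties using (allFin⁺)
open import Data.Product using (_×_; _,_; proj₁; proj₂)
open import Data.Sum using (_⊎_; inj₁; inj₂)
open import Relation.Nullary using (yes; no; contradiction)
open import Relation.Nullary.Decidable using (⌊_⌋)
open import Relation.Binary.Definitions using (DecidableEquality)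
open import Relation.Binary.PropositionalEquality
open import Defs

∑ : {Ω : Set} → List Ω → (Ω → ℤ) → ℤ
∑ []       f = 0ℤ
∑ (x ∷ xs) f = f x + ∑ xs f

size : {Ω : Set} → List Ω → ℤ
size xs = + length xs

sq : ℤ → ℤ
sq a = a * a

-- N² · Var[f] for the uniform distribution on the N points of xs: the
-- variance with its denominator cleared, an integer.
scaledVar : {Ω : Set} → List Ω → (Ω → ℤ) → ℤ
scaledVar xs f = size xs * ∑ xs (λ x → sq (f x)) - sq (∑ xs f)

Close : ℤ → ℤ → ℤ → Set
Close d a b = (a ≤ b + d) × (b ≤ a + d)

≤-by-gap : ∀ {a b} c → 0ℤ ≤ c → a + c ≡ b → a ≤ b
≤-by-gap c 0≤c refl = ℤP.i≤i+j _ c {{ℤ.nonNegative 0≤c}}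

*-nonNeg : ∀ {a b} → 0ℤ ≤ a → 0ℤ ≤ b → 0ℤ ≤ a * b
*-nonNeg {+ m} {+ n} _ _ = subst (0ℤ ≤_) (ℤP.pos-* m n) (+≤+ z≤n)

sq-nonNeg : ∀ a → 0ℤ ≤ sq a
sq-nonNeg (+ n)    = *-nonNeg {+ n} {+ n} (+≤+ z≤n) (+≤+ z≤n)
sq-nonNeg -[1+ n ] = +≤+ z≤n

-- |a - b| ≤ d implies (a - b)² ≤ d², since d² - (a - b)² = (b + d - a)(a + d - b).
close-sq : ∀ {d a b} → Close d a b → sq (a - b) ≤ sq d
close-sq {d} {a} {b} (a≤b+d , b≤a+d) =
  ≤-by-gap _ (*-nonNeg (ℤP.i≤j⇒0≤j-i a≤b+d) (ℤP.i≤j⇒0≤j-i b≤a+d)) (difference-of-squares a b d)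
  where
  difference-of-squares : ∀ a b d → (a - b) * (a - b) + (b + d - a) * (a + d - b) ≡ d * d
  difference-of-squares = solve-∀

module _ {Ω : Set} where

  ∑-cong : ∀ (xs : List Ω) {f g} → (∀ x → f x ≡ g x) → ∑ xs f ≡ ∑ xs g
  ∑-cong []       f≗g = refl
  ∑-cong (x ∷ xs) f≗g = cong₂ _+_ (f≗g x) (∑-cong xs f≗g)

  ∑-mono : ∀ (xs : List Ω) {f g} → (∀ x → f x ≤ g x) → ∑ xs f ≤ ∑ xs g
  ∑-mono []       f≤g = ℤP.≤-refl
  ∑-mono (x ∷ xs) f≤g = ℤP.+-mono-≤ (f≤g x) (∑-mono xs f≤g)

  ∑-const : ∀ (xs : List Ω) c → ∑ xs (λ _ → c) ≡ size xs * c
  ∑-const []       c = sym (ℤP.*-zeroˡ c)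
  ∑-const (x ∷ xs) c = trans (cong (_+_ c) (∑-const xs c)) (sym (ℤP.suc-* (size xs) c))

  ∑-+ : ∀ (xs : List Ω) f g → ∑ xs (λ x → f x + g x) ≡ ∑ xs f + ∑ xs g
  ∑-+ []       f g = refl
  ∑-+ (x ∷ xs) f g = trans (cong (_+_ (f x + g x)) (∑-+ xs f g)) (interchange (f x) (g x) _ _)
    where
    interchange : ∀ a b c d → a + b + (c + d) ≡ a + c + (b + d)
    interchange = solve-∀

  ∑-linear : ∀ (xs : List Ω) c f g → ∑ xs (λ x → c * f x - g x) ≡ c * ∑ xs f - ∑ xs g
  ∑-linear []       c f g = vanish c
    where
    vanish : ∀ c → 0ℤ ≡ c * 0ℤ - 0ℤ
    vanish = solve-∀
  ∑-linear (x ∷ xs) c f g = trans (cong (_+_ (c * f x - g x)) (∑-linear xs c f g)) (collect c (f x) (g x) _ _)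
    where
    collect : ∀ c u v U V → c * u - v + (c * U - V) ≡ c * (u + U) - (v + V)
    collect = solve-∀

  ∑-++ : ∀ (xs ys : List Ω) f → ∑ (xs ++ ys) f ≡ ∑ xs f + ∑ ys f
  ∑-++ []       ys f = sym (ℤP.+-identityˡ _)
  ∑-++ (x ∷ xs) ys f = trans (cong (_+_ (f x)) (∑-++ xs ys f)) (sym (ℤP.+-assoc (f x) _ _))

  ∑-map : ∀ {Ψ : Set} (g : Ψ → Ω) (xs : List Ψ) f → ∑ (map g xs) f ≡ ∑ xs (λ x → f (g x))
  ∑-map g []       f = refl
  ∑-map g (x ∷ xs) f = cong (_+_ (f (g x))) (∑-map g xs f)

  ∑-concatMap : ∀ {I : Set} (g : I → List Ω) (is : List I) f →
                ∑ (concatMap g is) f ≡ ∑ is (λ i → ∑ (g i) f)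
  ∑-concatMap g []       f = refl
  ∑-concatMap g (i ∷ is) f = trans (∑-++ (g i) _ f) (cong (_+_ (∑ (g i) f)) (∑-concatMap g is f))

  close-∑ : ∀ (xs : List Ω) {d f g} → (∀ x → Close d (f x) (g x)) →
            Close (size xs * d) (∑ xs f) (∑ xs g)
  close-∑ xs {d} close = within (λ x → proj₁ (close x)) , within (λ x → proj₂ (close x))
    where
    within : ∀ {u v} → (∀ x → u x ≤ v x + d) → ∑ xs u ≤ ∑ xs v + size xs * d
    within {u} {v} u≤v+d = ℤP.≤-trans (∑-mono xs u≤v+d)
      (ℤP.≤-reflexive (trans (∑-+ xs v (λ _ → d)) (cong (_+_ (∑ xs v)) (∑-const xs d))))

  scaledVar-cong : ∀ (xs : List Ω) {f g} → (∀ x → f x ≡ g x) → scaledVar xs f ≡ scaledVar xs g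
  scaledVar-cong xs f≗g =
    cong₂ (λ s t → size xs * s - sq t) (∑-cong xs (λ x → cong sq (f≗g x))) (∑-cong xs f≗g)

  scaledVar-map : ∀ {Ψ : Set} (g : Ψ → Ω) (xs : List Ψ) f →
                  scaledVar (map g xs) f ≡ scaledVar xs (λ x → f (g x))
  scaledVar-map g xs f = trans
    (cong₂ (λ n s → + n * s - sq (∑ (map g xs) f)) (ListP.length-map g xs) (∑-map g xs (λ x → sq (f x))))
    (cong (λ t → size xs * ∑ xs (λ x → sq (f (g x))) - sq t) (∑-map g xs f))

  ∑-sq-deviation : ∀ (xs : List Ω) f a →
    ∑ xs (λ y → sq (a - f y)) ≡ size xs * sq a - + 2 * a * ∑ xs f + ∑ xs (λ y → sq (f y))
  ∑-sq-deviation []       f a = vanish a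
    where
    vanish : ∀ a → 0ℤ ≡ 0ℤ * (a * a) - + 2 * a * 0ℤ + 0ℤ
    vanish = solve-∀
  ∑-sq-deviation (y ∷ ys) f a =
    trans (cong (_+_ (sq (a - f y))) (∑-sq-deviation ys f a)) (expand a (f y) (size ys) (∑ ys f) _)
    where
    expand : ∀ a u N S T → (a - u) * (a - u) + (N * (a * a) - + 2 * a * S + T)
                         ≡ (1ℤ + N) * (a * a) - + 2 * a * (u + S) + (u * u + T)
    expand = solve-∀

  scaledVar-cons : ∀ x (xs : List Ω) f →
    scaledVar (x ∷ xs) f ≡ ∑ xs (λ y → sq (f x - f y)) + scaledVar xs f
  scaledVar-cons x xs f = trans
    (regroup (f x) (size xs) (∑ xs f) (∑ xs (λ y → sq (f y))))
    (cong (λ t → t + scaledVar xs f) (sym (∑-sq-deviation xs f (f x))))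
    where
    regroup : ∀ a N S T → (1ℤ + N) * (a * a + T) - (a + S) * (a + S)
                        ≡ (N * (a * a) - + 2 * a * S + T) + (N * T - S * S)
    regroup = solve-∀

  scaledVar-bounded : ∀ (xs : List Ω) f d → (∀ x y → Close d (f x) (f y)) →
                      scaledVar xs f ≤ sq d * sq (size xs)
  scaledVar-bounded []       f d close = ℤP.≤-reflexive (sym (ℤP.*-zeroʳ (sq d)))
  scaledVar-bounded (x ∷ xs) f d close = begin
    scaledVar (x ∷ xs) f                            ≡⟨ scaledVar-cons x xs f ⟩
    ∑ xs (λ y → sq (f x - f y)) + scaledVar xs f    ≤⟨ ℤP.+-mono-≤ deviations (scaledVar-bounded xs f d close) ⟩
    ∑ xs (λ _ → sq d) + sq d * sq N                 ≡⟨ cong (_+ sq d * sq N) (∑-const xs (sq d)) ⟩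
    N * sq d + sq d * sq N                          ≤⟨ ≤-by-gap _ (*-nonNeg (sq-nonNeg d) (+≤+ z≤n)) (square-step N (sq d)) ⟩
    sq d * sq (1ℤ + N)                              ∎
    where
    open ℤP.≤-Reasoning
    N = size xs
    deviations : ∑ xs (λ y → sq (f x - f y)) ≤ ∑ xs (λ _ → sq d)
    deviations = ∑-mono xs (λ y → close-sq (close x y))
    square-step : ∀ N e → N * e + e * (N * N) + e * (1ℤ + N) ≡ e * ((1ℤ + N) * (1ℤ + N))
    square-step = solve-∀

-- Law of total variance for a sample space made of equal-size blocks: the
-- variance is the mean within-block variance plus the variance of the block means.
module _ {I Ω : Set} (block : I → List Ω) (M : ℕ) (uniform : ∀ i → length (block i) ≡ M) where

  size-concatMap : ∀ is → size (concatMap block is) ≡ size is * + M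
  size-concatMap is = trans (cong +_ (length-concatMap is)) (ℤP.pos-* (length is) M)
    where
    length-concatMap : ∀ is → length (concatMap block is) ≡ length is ℕ.* M
    length-concatMap []       = refl
    length-concatMap (i ∷ is) =
      trans (ListP.length-++ (block i)) (cong₂ ℕ._+_ (uniform i) (length-concatMap is))

  total-variance : ∀ is f → scaledVar (concatMap block is) f
    ≡ size is * ∑ is (λ i → scaledVar (block i) f) + scaledVar is (λ i → ∑ (block i) f)
  total-variance is f = begin
    scaledVar (concatMap block is) f
      ≡⟨ cong₂ (λ n t → n * t - sq (∑ (concatMap block is) f)) (size-concatMap is) (∑-concatMap block is _) ⟩
    size is * + M * ∑ is T - sq (∑ (concatMap block is) f)
      ≡⟨ cong (λ s → size is * + M * ∑ is T - sq s) (∑-concatMap block is f) ⟩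
    size is * + M * ∑ is T - sq (∑ is S)
      ≡⟨ regroup (size is) (+ M) (∑ is T) (∑ is (λ i → sq (S i))) (∑ is S) ⟩
    size is * (+ M * ∑ is T - ∑ is (λ i → sq (S i))) + scaledVar is S
      ≡⟨ cong (λ t → size is * t + scaledVar is S) (sym within-blocks) ⟩
    size is * ∑ is (λ i → scaledVar (block i) f) + scaledVar is S ∎
    where
    open ≡-Reasoning
    S T : I → ℤ
    S i = ∑ (block i) f
    T i = ∑ (block i) (λ x → sq (f x))
    within-blocks : ∑ is (λ i → scaledVar (block i) f) ≡ + M * ∑ is T - ∑ is (λ i → sq (S i))
    within-blocks = trans (∑-cong is (λ i → cong (λ n → + n * T i - sq (S i)) (uniform i)))
                          (∑-linear is (+ M) T (λ i → sq (S i)))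
    regroup : ∀ m M t q s → m * M * t - s * s ≡ m * (M * t - q) + (m * q - s * s)
    regroup = solve-∀

  total-variance-≤ : ∀ is f a b →
    scaledVar is (λ i → ∑ (block i) f) ≤ a * sq (size is * + M) →
    (∀ i → scaledVar (block i) f ≤ b * sq (+ M)) →
    scaledVar (concatMap block is) f ≤ (a + b) * sq (size (concatMap block is))
  total-variance-≤ is f a b between within = begin
    scaledVar (concatMap block is) f
      ≡⟨ total-variance is f ⟩
    size is * ∑ is (λ i → scaledVar (block i) f) + scaledVar is (λ i → ∑ (block i) f)
      ≤⟨ ℤP.+-mono-≤ (ℤP.*-monoˡ-≤-nonNeg (size is) within-total) between ⟩
    size is * (size is * (b * sq (+ M))) + a * sq (size is * + M)
      ≡⟨ collect (size is) (+ M) a b ⟩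
    (a + b) * sq (size is * + M)
      ≡⟨ cong (λ n → (a + b) * sq n) (size-concatMap is) ⟨
    (a + b) * sq (size (concatMap block is)) ∎
    where
    open ℤP.≤-Reasoning
    within-total : ∑ is (λ i → scaledVar (block i) f) ≤ size is * (b * sq (+ M))
    within-total = ℤP.≤-trans (∑-mono is within) (ℤP.≤-reflexive (∑-const is _))
    collect : ∀ m M a b → m * (m * (b * (M * M))) + a * ((m * M) * (m * M)) ≡ (a + b) * ((m * M) * (m * M))
    collect = solve-∀

Lipschitz : {K : ℕ} → ℤ → (n : ℕ) → (Vec (Fin K) n → ℤ) → Set
Lipschitz d n f = ∀ v k i → Close d (f v) (f (v [ k ]≔ i))

lipschitz-∑ : ∀ {K n d} {Y : Set} (ys : List Y) (F : Vec (Fin K) n → Y → ℤ) →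
              (∀ y → Lipschitz d n (λ v → F v y)) → Lipschitz (size ys * d) n (λ v → ∑ ys (F v))
lipschitz-∑ ys F lipschitz v k i = close-∑ ys (λ y → lipschitz y v k i)

-- Induction on n, splitting the sample space by the
-- first coordinate: the blocks are the (n-1)-dimensional spaces, and the block
-- sums differ by at most N d since they differ only in the first coordinate.
efron-stein : ∀ {K} n (f : Vec (Fin K) n → ℤ) d → Lipschitz d n f →
              scaledVar (allPlacements K n) f ≤ + n * sq d * sq (size (allPlacements K n))
efron-stein zero    f d lipschitz = ℤP.≤-reflexive (singleton (f []))
  where
  singleton : ∀ a → 1ℤ * (a * a + 0ℤ) - (a + 0ℤ) * (a + 0ℤ) ≡ 0ℤ
  singleton = solve-∀
efron-stein {K} (suc n) f d lipschitz = begin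
  scaledVar (concatMap block (allFin K)) f
    ≤⟨ total-variance-≤ block (length P) (λ i → ListP.length-map (i ∷_) P) (allFin K) f
         (sq d) (+ n * sq d) between within ⟩
  (sq d + + n * sq d) * sq (size (concatMap block (allFin K)))
    ≡⟨ cong (λ c → c * sq (size (concatMap block (allFin K)))) (ℤP.suc-* (+ n) (sq d)) ⟨
  + suc n * sq d * sq (size (concatMap block (allFin K))) ∎
  where
  open ℤP.≤-Reasoning
  P = allPlacements K n
  block : Fin K → List (Vec (Fin K) (suc n))
  block i = map (i ∷_) P
  within : ∀ i → scaledVar (block i) f ≤ + n * sq d * sq (size P)
  within i = ℤP.≤-trans (ℤP.≤-reflexive (scaledVar-map (i ∷_) P f))
                        (efron-stein n (λ v → f (i ∷ v)) d (λ v k j → lipschitz (i ∷ v) (suc k) j))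
  reshape : ∀ m M d → (M * d) * (M * d) * (m * m) ≡ d * d * ((m * M) * (m * M))
  reshape = solve-∀
  between : scaledVar (allFin K) (λ i → ∑ (block i) f) ≤ sq d * sq (size (allFin K) * size P)
  between = begin
    scaledVar (allFin K) (λ i → ∑ (block i) f)
      ≡⟨ scaledVar-cong (allFin K) (λ i → ∑-map (i ∷_) P f) ⟩
    scaledVar (allFin K) (λ i → ∑ P (λ v → f (i ∷ v)))
      ≤⟨ scaledVar-bounded (allFin K) _ (size P * d) (λ i j → close-∑ P (λ v → lipschitz (i ∷ v) zero j)) ⟩
    sq (size P * d) * sq (size (allFin K))
      ≡⟨ reshape (size (allFin K)) (size P) d ⟩
    sq d * sq (size (allFin K) * size P) ∎

cartesianProduct-blocks : ∀ {X Y : Set} (xs : List X) (ys : List Y) →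
                          cartesianProduct xs ys ≡ concatMap (λ x → map (x ,_) ys) xs
cartesianProduct-blocks []       ys = refl
cartesianProduct-blocks (x ∷ xs) ys = cong (map (x ,_) ys ++_) (cartesianProduct-blocks xs ys)

product-variance : ∀ {X Y : Set} (xs : List X) (ys : List Y) (F : X × Y → ℤ) a b →
  scaledVar xs (λ x → ∑ ys (λ y → F (x , y))) ≤ a * sq (size xs * size ys) →
  (∀ x → scaledVar ys (λ y → F (x , y)) ≤ b * sq (size ys)) →
  scaledVar (cartesianProduct xs ys) F ≤ (a + b) * sq (size (cartesianProduct xs ys))
product-variance xs ys F a b between within rewrite cartesianProduct-blocks xs ys =
  total-variance-≤ (λ x → map (x ,_) ys) (length ys) (λ x → ListP.length-map (x ,_) ys) xs F a b
    (ℤP.≤-trans (ℤP.≤-reflexive (scaledVar-cong xs (λ x → ∑-map (x ,_) ys F))) between)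
    (λ x → ℤP.≤-trans (ℤP.≤-reflexive (scaledVar-map (x ,_) ys F)) (within x))

outcome-variance : ∀ {K A B} (F : Vec (Fin K) A × Vec (Fin K) B → ℤ) d →
  (∀ bad → Lipschitz d A (λ good → F (good , bad))) →
  (∀ good → Lipschitz d B (λ bad → F (good , bad))) →
  scaledVar (outcomes K A B) F ≤ + (A ℕ.+ B) * sq d * sq (size (outcomes K A B))
outcome-variance {K} {A} {B} F d good-lipschitz bad-lipschitz = begin
  scaledVar (outcomes K A B) F
    ≤⟨ product-variance PA PB F (+ A * sq d) (+ B * sq d) between within ⟩
  (+ A * sq d + + B * sq d) * sq (size (outcomes K A B))
    ≡⟨ cong (λ c → c * sq (size (outcomes K A B)))
            (trans (sym (ℤP.*-distribʳ-+ (sq d) (+ A) (+ B))) (cong (_* sq d) (sym (ℤP.pos-+ A B)))) ⟩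
  + (A ℕ.+ B) * sq d * sq (size (outcomes K A B)) ∎
  where
  open ℤP.≤-Reasoning
  PA = allPlacements K A
  PB = allPlacements K B
  reshape : ∀ a M N d → a * ((M * d) * (M * d)) * (N * N) ≡ a * (d * d) * ((N * M) * (N * M))
  reshape = solve-∀
  between : scaledVar PA (λ good → ∑ PB (λ bad → F (good , bad))) ≤ + A * sq d * sq (size PA * size PB)
  between = ℤP.≤-trans
    (efron-stein A _ (size PB * d) (lipschitz-∑ PB (λ good bad → F (good , bad)) good-lipschitz))
    (ℤP.≤-reflexive (reshape (+ A) (size PB) (size PA) d))
  within : ∀ good → scaledVar PB (λ bad → F (good , bad)) ≤ + B * sq d * sq (size PB)
  within good = efron-stein B _ d (bad-lipschitz good)

count : {A : Set} → (A → Bool) → List A → ℕ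
count p xs = length (filterᵇ p xs)

module _ {A : Set} where

  count-≤-cons : ∀ (p : A → Bool) x xs → count p xs ℕ.≤ count p (x ∷ xs)
  count-≤-cons p x xs with p x
  ... | true  = ℕP.n≤1+n _
  ... | false = ℕP.≤-refl

  count-cover : ∀ (p q r : A → Bool) xs → (∀ x → p x ≡ true → q x ≡ true ⊎ r x ≡ true) →
                count p xs ℕ.≤ count q xs ℕ.+ count r xs
  count-cover p q r []       covered = z≤n
  count-cover p q r (x ∷ xs) covered with p x in px
  ... | false = ℕP.≤-trans (count-cover p q r xs covered)
                           (ℕP.+-mono-≤ (count-≤-cons q x xs) (count-≤-cons r x xs))
  ... | true with covered x px
  ...   | inj₁ qx rewrite qx = s≤s (ℕP.≤-trans (count-cover p q r xs covered)
                                               (ℕP.+-monoʳ-≤ (count q xs) (count-≤-cons r x xs)))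
  ...   | inj₂ rx rewrite rx = ℕP.≤-trans
    (s≤s (ℕP.≤-trans (count-cover p q r xs covered) (ℕP.+-monoˡ-≤ (count r xs) (count-≤-cons q x xs))))
    (ℕP.≤-reflexive (sym (ℕP.+-suc (count q (x ∷ xs)) (count r xs))))

  count-none : ∀ (p : A → Bool) xs → All (λ x → p x ≡ false) xs → count p xs ≡ 0
  count-none p []       All.[]            = refl
  count-none p (x ∷ xs) (px All.∷ pxs) rewrite px = count-none p xs pxs

  count-unique : (_≟ᴬ_ : DecidableEquality A) (a : A) {xs : List A} → Unique xs →
                 count (λ x → ⌊ a ≟ᴬ x ⌋) xs ℕ.≤ 1
  count-unique _≟ᴬ_ a {[]}     []                 = z≤n
  count-unique _≟ᴬ_ a {x ∷ xs} (x≢xs ∷ unique) with a ≟ᴬ x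
  ... | yes refl = s≤s (ℕP.≤-reflexive (count-none _ xs (All.map distinct x≢xs)))
    where
    distinct : ∀ {y} → a ≢ y → ⌊ a ≟ᴬ y ⌋ ≡ false
    distinct {y} a≢y with a ≟ᴬ y
    ... | yes a≡y = contradiction a≡y a≢y
    ... | no  _   = refl
  ... | no  _    = count-unique _≟ᴬ_ a unique

count-two-bins : ∀ {K} (p q : Fin K → Bool) (a i : Fin K) →
  (∀ j → a ≢ j → i ≢ j → q j ≡ p j) → count q (allFin K) ℕ.≤ count p (allFin K) ℕ.+ 2
count-two-bins {K} p q a i agree = ℕP.≤-trans
  (count-cover q p (λ j → ⌊ a ≟ j ⌋ ∨ ⌊ i ≟ j ⌋) (allFin K) away-or-at)
  (ℕP.+-monoʳ-≤ (count p (allFin K)) (ℕP.≤-trans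
    (count-cover _ (λ j → ⌊ a ≟ j ⌋) (λ j → ⌊ i ≟ j ⌋) (allFin K) at-a-or-i)
    (ℕP.+-mono-≤ (count-unique _≟_ a (allFin⁺ K)) (count-unique _≟_ i (allFin⁺ K)))))
  where
  away-or-at : ∀ j → q j ≡ true → p j ≡ true ⊎ (⌊ a ≟ j ⌋ ∨ ⌊ i ≟ j ⌋) ≡ true
  away-or-at j qj with a ≟ j | i ≟ j
  ... | yes _  | _      = inj₂ refl
  ... | no _   | yes _  = inj₂ refl
  ... | no a≢j | no i≢j = inj₁ (trans (sym (agree j a≢j i≢j)) qj)
  at-a-or-i : ∀ j → (⌊ a ≟ j ⌋ ∨ ⌊ i ≟ j ⌋) ≡ true → ⌊ a ≟ j ⌋ ≡ true ⊎ ⌊ i ≟ j ⌋ ≡ true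
  at-a-or-i j at with ⌊ a ≟ j ⌋
  ... | true  = inj₁ refl
  ... | false = inj₂ at

hits-update : ∀ {K n} (v : Vec (Fin K) n) k (i j : Fin K) → lookup v k ≢ j → i ≢ j →
              hits j (v [ k ]≔ i) ≡ hits j v
hits-update (x ∷ v) zero    i j x≢j i≢j with x ≟ j | i ≟ j
... | yes x≡j | _       = contradiction x≡j x≢j
... | no _    | yes i≡j = contradiction i≡j i≢j
... | no _    | no _    = refl
hits-update (x ∷ v) (suc k) i j x≢j i≢j = cong (⌊ x ≟ j ⌋ ∨_) (hits-update v k i j x≢j i≢j)

occupancy-lipschitz : ∀ {K n} (counted : Fin K → Bool → Bool) →
  Lipschitz (+ 2) n (λ v → + count (λ j → counted j (hits j v)) (allFin K))
occupancy-lipschitz counted v k i =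
  +≤+ (count-two-bins _ _ (lookup v k) i (λ j a≢j i≢j → sym (unchanged j a≢j i≢j))) ,
  +≤+ (count-two-bins _ _ (lookup v k) i unchanged)
  where
  unchanged : ∀ j → lookup v k ≢ j → i ≢ j → counted j (hits j (v [ k ]≔ i)) ≡ counted j (hits j v)
  unchanged j a≢j i≢j = cong (counted j) (hits-update v k i j a≢j i≢j)

sum-as-∑ : ∀ {Ω : Set} (xs : List Ω) (f : Ω → ℕ) → + sum (map f xs) ≡ ∑ xs (λ ω → + f ω)
sum-as-∑ []       f = refl
sum-as-∑ (x ∷ xs) f = trans (ℤP.pos-+ (f x) _) (cong (_+_ (+ f x)) (sum-as-∑ xs f))

variance-≤ᵘ : ∀ n s₁ s₂ c → + suc n * s₂ - sq s₁ ≤ c * sq (+ suc n) →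
              mkℚᵘ s₂ n ℚᵘ.- mkℚᵘ s₁ n ℚᵘ.* mkℚᵘ s₁ n ℚᵘ.≤ mkℚᵘ c 0
variance-≤ᵘ n s₁ s₂ c bound = *≤* (begin
  (s₂ * + (N ℕ.* N) + ℤ.- (s₁ * s₁) * + N) * 1ℤ
    ≡⟨ cong (λ t → (s₂ * t + ℤ.- (s₁ * s₁) * + N) * 1ℤ) (ℤP.pos-* N N) ⟩
  (s₂ * (+ N * + N) + ℤ.- (s₁ * s₁) * + N) * 1ℤ
    ≡⟨ cross-multiply s₁ s₂ (+ N) ⟩
  (+ N * s₂ - sq s₁) * + N
    ≤⟨ ℤP.*-monoʳ-≤-nonNeg (+ N) bound ⟩
  c * sq (+ N) * + N
    ≡⟨ reassociate c (+ N) ⟩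
  c * (+ N * (+ N * + N))
    ≡⟨ cong (λ t → c * (+ N * t)) (ℤP.pos-* N N) ⟨
  c * (+ N * + (N ℕ.* N))
    ≡⟨ cong (_*_ c) (ℤP.pos-* N (N ℕ.* N)) ⟨
  c * + (N ℕ.* (N ℕ.* N)) ∎)
  where
  open ℤP.≤-Reasoning
  N = suc n
  cross-multiply : ∀ s₁ s₂ N → (s₂ * (N * N) + ℤ.- (s₁ * s₁) * N) * 1ℤ ≡ (N * s₂ - s₁ * s₁) * N
  cross-multiply = solve-∀
  reassociate : ∀ c N → c * (N * N) * N ≡ c * (N * (N * N))
  reassociate = solve-∀

Var-≤ : ∀ {Ω : Set} (xs : List Ω) (f : Ω → ℕ) c →
        scaledVar xs (λ ω → + f ω) ≤ + c * sq (size xs) → Var xs f ℚ.≤ + c / 1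
Var-≤ []       f c _     = ℚP.nonNegative⁻¹ (+ c / 1) {{ℚP.normalize-nonNeg c 1}}
Var-≤ (x ∷ xs) f c bound =
  ℚP.toℚᵘ-cancel-≤ (ℚᵘP.≤-respʳ-≃ (ℚᵘP.≃-sym (ℚP.toℚᵘ-fromℚᵘ (mkℚᵘ (+ c) 0)))
                   (ℚᵘP.≤-respˡ-≃ (ℚᵘP.≃-sym unnormalised) (variance-≤ᵘ n s₁ s₂ (+ c) bound′)))
  where
  n = length xs
  s₁ s₂ : ℤ
  s₁ = + sum (map f (x ∷ xs))
  s₂ = + sum (map (λ ω → f ω ℕ.* f ω) (x ∷ xs))
  s₂-as-∑ : s₂ ≡ ∑ (x ∷ xs) (λ ω → sq (+ f ω))
  s₂-as-∑ = trans (sum-as-∑ (x ∷ xs) _) (∑-cong (x ∷ xs) (λ ω → ℤP.pos-* (f ω) (f ω)))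
  bound′ : + suc n * s₂ - sq s₁ ≤ + c * sq (+ suc n)
  bound′ = subst₂ (λ t s → + suc n * t - sq s ≤ + c * sq (+ suc n))
                  (sym s₂-as-∑) (sym (sum-as-∑ (x ∷ xs) f)) bound
  mean : ∀ s → toℚᵘ (s / suc n) ℚᵘ.≃ mkℚᵘ s n
  mean s = ℚP.toℚᵘ-fromℚᵘ (mkℚᵘ s n)
  unnormalised : toℚᵘ (Var (x ∷ xs) f) ℚᵘ.≃ mkℚᵘ s₂ n ℚᵘ.- mkℚᵘ s₁ n ℚᵘ.* mkℚᵘ s₁ n
  unnormalised = ℚᵘP.≃-trans (ℚP.toℚᵘ-homo-+ (s₂ / suc n) (ℚ.- ((s₁ / suc n) ℚ.* (s₁ / suc n))))
    (ℚᵘP.+-cong (mean s₂) (ℚᵘP.≃-trans (ℚP.toℚᵘ-homo‿- ((s₁ / suc n) ℚ.* (s₁ / suc n)))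
      (ℚᵘP.-‿cong (ℚᵘP.≃-trans (ℚP.toℚᵘ-homo-* (s₁ / suc n) (s₁ / suc n)) (ℚᵘP.*-cong (mean s₁) (mean s₁))))))

balls-≤ : ∀ {K A B} → 4 ℕ.* A ℕ.≤ K → 4 ℕ.* B ℕ.≤ K → (A ℕ.+ B) ℕ.* 4 ℕ.≤ 7 ℕ.* K
balls-≤ {K} {A} {B} 4A≤K 4B≤K = begin
  (A ℕ.+ B) ℕ.* 4     ≡⟨ trans (ℕP.*-comm (A ℕ.+ B) 4) (ℕP.*-distribˡ-+ 4 A B) ⟩
  4 ℕ.* A ℕ.+ 4 ℕ.* B ≤⟨ ℕP.+-mono-≤ 4A≤K 4B≤K ⟩
  K ℕ.+ K             ≤⟨ ℕP.+-monoʳ-≤ K (ℕP.m≤n*m K 6) ⟩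
  7 ℕ.* K             ∎
  where open ℕP.≤-Reasoning

-- X depends on the good balls only through which bins they hit, and likewise
-- for the bad balls; hence it has bounded differences 2 in every ball, and
-- Var[X] ≤ 4 (A + B) ≤ 7K.
mainTheorem18 : (K A B : ℕ) → 4 ℕ.* A ℕ.≤ K → 4 ℕ.* B ℕ.≤ K →
    Var (outcomes K A B) (X {K} {A} {B}) ℚ.≤ (+ (7 ℕ.* K)) / 1
mainTheorem18 K A B 4A≤K 4B≤K = Var-≤ (outcomes K A B) X (7 ℕ.* K) (begin
  scaledVar (outcomes K A B) (λ ω → + X ω)
    ≤⟨ outcome-variance {K} {A} {B} (λ ω → + X ω) (+ 2)
         (λ bad → occupancy-lipschitz (λ j hit → hit ∧ not (hits j bad)))
         (λ good → occupancy-lipschitz (λ j hit → hits j good ∧ not hit)) ⟩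
  + (A ℕ.+ B) * + 4 * sq N
    ≤⟨ ℤP.*-monoʳ-≤-nonNeg (sq N) {{ℤ.nonNegative (sq-nonNeg N)}}
         (ℤP.≤-trans (ℤP.≤-reflexive (sym (ℤP.pos-* (A ℕ.+ B) 4))) (+≤+ (balls-≤ {K} {A} {B} 4A≤K 4B≤K))) ⟩
  + (7 ℕ.* K) * sq N ∎)
  where
  open ℤP.≤-Reasoning
  N = size (outcomes K A B)
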